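{- Let $G_0,G_1,\dots,G_m$ be a chain decomposition of a graph $G$ rooted at $r$. Then for each $i=1,\dots,m$ the subgraphs $H_i$ and $\overline{H_{i-1}}$ are connected. Moreover, if $e$ is a cut edge of $H_i$ (respectively of $\overline{H_{i-1}}$), then $e$ induces a one-way chain (i.e. $G_{CI(e)}$ is a one-way chain) and one component of $H_i-e$ (respectively $\overline{H_{i-1}}-e$) consists of a single vertex and no edges.
   Context: Graphs are multigraphs (parallel edges and loops allowed; a loop adds $2$ to the degree; a loop is a cycle of length one and two parallel edges form a cycle of length two), with $|V(G)|\ge 1$. Paths and cycles are simple. The degree of a vertex in a subgraph not containing it is $0$. An up chain of $G$ with respect to a pair of edge-disjoint subgraphs $(H,\overline{H})$ is a subgraph of $G$, edge-disjoint from $H$ and $\overline{H}$, which is either (i) a path with at least one edge such that every vertex is either $r$ or has degree at least two in $\overline{H}$, and each end is either $r$ or lies in $H$; or (ii) a cycle such that every vertex is either $r$ or has degree at least two in $\overline{H}$, and some vertex $v$ of it is either $r$ or has degree at least two in $H$ ($v$ is regarded as both ends, all other vertices internal). A down chain with respect to $(H,\overline{H})$ is an up chain with respect to $(\overline{H},H)$. A one-way chain with respect to $(H,\overline{H})$ is the subgraph induced by a single edge $e\notin E(H)\cup E(\overline{H})$ with ends $u$ (tail) and $v$ (head) such that $u$ is $r$ or has degree at least two in $H$, and $v$ is $r$ or has degree at least two in $\overline{H}$. A sequence $G_0,\dots,G_m$ of subgraphs of $G$ is a chain decomposition of $G$ rooted at $r\in V(G)$ if, writing $H_i=G_0\cup\cdots\cup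 G_{i-1}$ and $\overline{H_i}=G_{i+1}\cup\cdots\cup G_m$ (so $H_0$ and $\overline{H_m}$ are null), the sets $E(G_0),\dots,E(G_m)$ partition $E(G)$ and each $G_i$ is an up chain, a down chain, or a one-way chain with respect to $(H_i,\overline{H_i})$. For an edge $e$, $CI(e)$ denotes the index $i$ with $e\in E(G_i)$. -}

module Defs where

open import Data.Nat using (ℕ; zero; suc; _≤_; _<_; _<ᵇ_)
open import Data.Fin using (Fin; zero; suc; toℕ; fromℕ; inject₁)
open import Data.Fin.Properties using (_≟_)
open import Data.Bool using (Bool; true; false; T; _∧_; not; if_then_else_)
open import Data.List using (List; allFin; map)
open import Data.Nat.ListAction using (sum)
open import Data.Bool.ListAction using (any)
open import Data.Product using (Σ; ∃; _×_; _,_)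
open import Data.Sum using (_⊎_)
open import Relation.Nullary using (¬_; ⌊_⌋)
open import Relation.Binary.PropositionalEquality using (_≡_)

-- Parallel edges are allowed.
-- The orientation src/tgt carries no meaning (graphs are undirected).

record Graph : Set where
  field
    nV nE : ℕ
    src tgt : Fin nE → Fin nV
open Graph public

Vtx : Graph → Set
Vtx G = Fin (nV G)

Edge : Graph → Set
Edge G = Fin (nE G)

Joins : (G : Graph) → Edge G → Vtx G → Vtx G → Set
Joins G e x y = (src G e ≡ x × tgt G e ≡ y) ⊎ (src G e ≡ y × tgt G e ≡ x)

Incident : (G : Graph) → Edge G → Vtx G → Set
Incident G e v = src G e ≡ v ⊎ tgt G e ≡ v

Injective : ∀ {A : Set} {n} → (Fin n → A) → Set
Injective {A} {n} f = ∀ (i j : Fin n) → f i ≡ f j → i ≡ j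

record Sub (G : Graph) : Set where
  field
    inV : Vtx G → Bool
    inE : Edge G → Bool
open Sub public

module _ {G : Graph} where

  _∈V_ : Vtx G → Sub G → Set
  v ∈V S = T (inV S v)

  _∈E_ : Edge G → Sub G → Set
  e ∈E S = T (inE S e)

  -- number of ends of e equal to v (a loop at v contributes 2)
  mult : Edge G → Vtx G → ℕ
  mult e v = (if ⌊ src G e ≟ v ⌋ then 1 else 0) + (if ⌊ tgt G e ≟ v ⌋ then 1 else 0)
    where open Data.Nat using (_+_)

  deg : Sub G → Vtx G → ℕ
  deg S v = sum (map (λ e → if inE S e then mult e v else 0) (allFin (nE G)))

  _─_ : Sub G → Edge G → Sub G
  inV (S ─ e) v = inV S v
  inE (S ─ e) f = inE S f ∧ not ⌊ f ≟ e ⌋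

  data Reach (S : Sub G) : Vtx G → Vtx G → Set where
    here : ∀ {x} → Reach S x x
    step : ∀ {x y z} (e : Edge G) → e ∈E S → Joins G e x y → Reach S y z → Reach S x z

  Connected : Sub G → Set
  Connected S = (∃ λ v → v ∈V S)
              × (∀ x y → x ∈V S → y ∈V S → Reach S x y)

  -- e is a cut edge of S: an edge of S whose deletion disconnects two
  -- vertices that were connected in S (i.e. increases the number of components)
  CutEdge : Sub G → Edge G → Set
  CutEdge S e = e ∈E S × Σ (Vtx G) λ x → Σ (Vtx G) λ y →
                x ∈V S × y ∈V S × Reach S x y × ¬ Reach (S ─ e) x y

  HasTrivialComponent : Sub G → Edge G → Set
  HasTrivialComponent S e = Σ (Vtx G) λ w → w ∈V S
    × (∀ x → Reach (S ─ e) w x → x ≡ w)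
    × (∀ f → f ∈E (S ─ e) → ¬ Incident G f w)

  SpannedBy : ∀ {p q} → Sub G → (Fin p → Vtx G) → (Fin q → Edge G) → Set
  SpannedBy S vs es =
      (∀ v → (v ∈V S → ∃ λ j → vs j ≡ v) × ((∃ λ j → vs j ≡ v) → v ∈V S))
    × (∀ e → (e ∈E S → ∃ λ j → es j ≡ e) × ((∃ λ j → es j ≡ e) → e ∈E S))

  IsPath : Sub G → Vtx G → Vtx G → Set
  IsPath S a b = Σ ℕ λ k → Σ (Fin (suc (suc k)) → Vtx G) λ vs → Σ (Fin (suc k) → Edge G) λ es →
      Injective vs × Injective es
    × (∀ j → Joins G (es j) (vs (inject₁ j)) (vs (suc j)))
    × SpannedBy S vs es
    × vs zero ≡ a × vs (fromℕ (suc k)) ≡ b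

-- cyclic successor on Fin (suc n)
next : ∀ {n} → Fin (suc n) → Fin (suc n)
next {zero} zero = zero
next {suc n} zero = suc zero
next {suc n} (suc j) with next j
... | zero = zero
... | suc k = suc (suc k)

module _ {G : Graph} where

  -- S is a cycle of length suc k ≥ 1 (length 1: a loop; length 2: two
  -- parallel edges)
  IsCycle : Sub G → Set
  IsCycle S = Σ ℕ λ k → Σ (Fin (suc k) → Vtx G) λ vs → Σ (Fin (suc k) → Edge G) λ es →
      Injective vs × Injective es
    × (∀ j → Joins G (es j) (vs j) (vs (next j)))
    × SpannedBy S vs es

  EdgeDisjoint : Sub G → Sub G → Sub G → Set
  EdgeDisjoint C H Hb = ∀ e → e ∈E C → ¬ (e ∈E H) × ¬ (e ∈E Hb)

  UpChain : Vtx G → Sub G → Sub G → Sub G → Set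
  UpChain r H Hb C = EdgeDisjoint C H Hb ×
    ( (Σ (Vtx G) λ a → Σ (Vtx G) λ b → IsPath C a b
         × (∀ v → v ∈V C → v ≡ r ⊎ 2 ≤ deg Hb v)
         × (a ≡ r ⊎ a ∈V H) × (b ≡ r ⊎ b ∈V H))
    ⊎ (IsCycle C
         × (∀ v → v ∈V C → v ≡ r ⊎ 2 ≤ deg Hb v)
         × (Σ (Vtx G) λ v → v ∈V C × (v ≡ r ⊎ 2 ≤ deg H v))))

  DownChain : Vtx G → Sub G → Sub G → Sub G → Set
  DownChain r H Hb C = UpChain r Hb H C

  -- one-way chain w.r.t. (H, Hb): subgraph induced by one edge e with
  -- tail u and head v
  OneWayChain : Vtx G → Sub G → Sub G → Sub G → Set
  OneWayChain r H Hb C = Σ (Edge G) λ e → ¬ (e ∈E H) × ¬ (e ∈E Hb)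
    × (∀ v → (v ∈V C → Incident G e v) × (Incident G e v → v ∈V C))
    × (∀ f → (f ∈E C → f ≡ e) × (f ≡ e → f ∈E C))
    × Σ (Vtx G) λ u → Σ (Vtx G) λ v → Joins G e u v
        × (u ≡ r ⊎ 2 ≤ deg H u) × (v ≡ r ⊎ 2 ≤ deg Hb v)

  IsChain : Vtx G → Sub G → Sub G → Sub G → Set
  IsChain r H Hb C = UpChain r H Hb C ⊎ DownChain r H Hb C ⊎ OneWayChain r H Hb C

  -- union of the G_j with j < i  (H_i)
  Hpre : ∀ {m} → (Fin (suc m) → Sub G) → ℕ → Sub G
  inV (Hpre {m} Gs i) v = any (λ j → (toℕ j <ᵇ i) ∧ inV (Gs j) v) (allFin (suc m))
  inE (Hpre {m} Gs i) e = any (λ j → (toℕ j <ᵇ i) ∧ inE (Gs j) e) (allFin (suc m))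

  -- union of the G_j with j > i  (H̄_i)
  Hsuf : ∀ {m} → (Fin (suc m) → Sub G) → ℕ → Sub G
  inV (Hsuf {m} Gs i) v = any (λ j → (i <ᵇ toℕ j) ∧ inV (Gs j) v) (allFin (suc m))
  inE (Hsuf {m} Gs i) e = any (λ j → (i <ᵇ toℕ j) ∧ inE (Gs j) e) (allFin (suc m))

  IsChainDecomposition : Vtx G → (m : ℕ) → (Fin (suc m) → Sub G) → Set
  IsChainDecomposition r m Gs =
      (∀ (e : Edge G) → Σ (Fin (suc m)) λ j → e ∈E Gs j × (∀ j' → e ∈E Gs j' → j' ≡ j))
    × (∀ (i : Fin (suc m)) → IsChain r (Hpre Gs (toℕ i)) (Hsuf Gs (toℕ i)) (Gs i))

-- Add the chains one at a time: G₀, G₁, … to build H_i, and G_m, G_{m-1}, … to build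
-- H̄_{i-1}, where up and down chains trade roles. Every union P met on the way is closed
-- (edge ends are vertices), every vertex of P is joined to r inside P, and every bridge f
-- of P comes from a one-way chain and ends at a leaf w ≠ r whose only edge is f. A new
-- path or cycle creates no bridge, because its ends (or some vertex of the cycle) are
-- already joined to r in P; a new one-way edge uv is a bridge only if its head v is new,
-- and then v is a leaf. An old bridge f stays a bridge, so no new chain can reach its leaf
-- w: since w is not r and has degree 1 in P, the chain would meet w away from where it is
-- attached and so join w to the rest of P without using f.

module Submission where

open import Defs
open import Data.Nat using (ℕ; zero; suc; _+_; _∸_; _≤_; _<_; _<ᵇ_; z≤n; s≤s)
open import Data.Nat.Properties
  using ( ≤-refl; ≤-trans; <-trans; <-≤-trans; <-irrefl; <⇒≤; n≤1+n; m≤n⇒m≤1+n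
        ; m<n⇒m<1+n; m≤n⇒m<n∨m≡n; <ᵇ⇒<; <⇒<ᵇ; +-identityʳ
        ; m∸n≤m; m∸[m∸n]≡n; m<n⇒0<n∸m; ∸-monoʳ-<; +-∸-assoc)
open import Data.Fin using (Fin; zero; suc; toℕ; fromℕ; fromℕ<; inject₁)
open import Data.Fin.Properties
  using ( _≟_; toℕ-injective; toℕ≤pred[n]; toℕ-fromℕ; toℕ-fromℕ<; toℕ-inject₁
        ; 0≢1+n; suc-injective)
open import Data.Bool using (Bool; true; false; T; _∧_; if_then_else_)
open import Data.Bool.Properties using (T-∧)
open import Data.Bool.ListAction using (any)
open import Data.List using (allFin; tabulate)
open import Data.List.Properties using (map-tabulate)
open import Data.List.Relation.Unary.Any.Properties using (any⁺; any⁻)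
open import Data.List.Membership.Propositional using (find; lose)
open import Data.List.Membership.Propositional.Properties using (∈-allFin)
open import Data.Nat.ListAction using (sum)
open import Data.Product using (∃; ∃₂; _×_; _,_; proj₁; proj₂; swap)
open import Data.Sum using (_⊎_; inj₁; inj₂; [_,_]′)
open import Data.Empty using (⊥-elim)
open import Data.Unit using (tt)
open import Function using (_∘_; Equivalence)
open import Relation.Nullary using (¬_; yes; no)
open import Relation.Nullary.Decidable using (T?)
open import Relation.Binary.PropositionalEquality
  using (_≡_; _≢_; refl; sym; trans; cong; subst; subst₂)

any-allFin⁻ : ∀ {n} (p : Fin n → Bool) → T (any p (allFin n)) → ∃ λ j → T (p j)
any-allFin⁻ p h = let j , _ , pj = find (any⁻ p (allFin _) h) in j , pj

any-allFin⁺ : ∀ {n} (p : Fin n → Bool) j → T (p j) → T (any p (allFin n))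
any-allFin⁺ p j pj = any⁺ p (lose {P = T ∘ p} (∈-allFin j) pj)

module _ {n : ℕ} where

  Below Above : ℕ → (Fin n → Bool) → Set
  Below k b = T (any (λ j → (toℕ j <ᵇ k) ∧ b j) (allFin n))
  Above k b = T (any (λ j → (k <ᵇ toℕ j) ∧ b j) (allFin n))

  below⁻ : ∀ {k} b → Below k b → ∃ λ j → toℕ j < k × T (b j)
  below⁻ b h = let j , t = any-allFin⁻ _ h ; lt , bj = Equivalence.to T-∧ t in j , <ᵇ⇒< _ _ lt , bj

  below⁺ : ∀ {k} b j → toℕ j < k → T (b j) → Below k b
  below⁺ b j lt bj = any-allFin⁺ _ j (Equivalence.from T-∧ (<⇒<ᵇ lt , bj))

  above⁻ : ∀ {k} b → Above k b → ∃ λ j → k < toℕ j × T (b j)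
  above⁻ b h = let j , t = any-allFin⁻ _ h ; lt , bj = Equivalence.to T-∧ t in j , <ᵇ⇒< _ _ lt , bj

  above⁺ : ∀ {k} b j → k < toℕ j → T (b j) → Above k b
  above⁺ b j lt bj = any-allFin⁺ _ j (Equivalence.from T-∧ (<⇒<ᵇ lt , bj))

  below-zero : ∀ b → ¬ Below 0 b
  below-zero b h with below⁻ {0} b h
  ... | _ , () , _

  below-suc⁻ : ∀ b i → Below (suc (toℕ i)) b → Below (toℕ i) b ⊎ T (b i)
  below-suc⁻ b i h with below⁻ {suc (toℕ i)} b h
  ... | j , s≤s j≤i , bj with m≤n⇒m<n∨m≡n j≤i
  ...   | inj₁ j<i = inj₁ (below⁺ b j j<i bj)
  ...   | inj₂ j≡i = inj₂ (subst (T ∘ b) (toℕ-injective j≡i) bj)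

  below-suc : ∀ {k} b → Below k b → Below (suc k) b
  below-suc b h = let j , lt , bj = below⁻ b h in below⁺ b j (m<n⇒m<1+n lt) bj

  below-self : ∀ b i → T (b i) → Below (suc (toℕ i)) b
  below-self b i = below⁺ b i ≤-refl

  above-pred : ∀ {k} b → Above (suc k) b → Above k b
  above-pred b h = let j , lt , bj = above⁻ b h in above⁺ b j (<⇒≤ lt) bj

module _ {m : ℕ} where

  above-last : ∀ (b : Fin (suc m) → Bool) → ¬ Above m b
  above-last b h with above⁻ b h
  ... | j , m<j , _ = <-irrefl refl (<-≤-trans m<j (toℕ≤pred[n] j))

  above-pred⁻ : ∀ (b : Fin (suc m) → Bool) i
              → Above (toℕ i) b → Above (suc (toℕ i)) b ⊎ T (b (suc i))
  above-pred⁻ b i h with above⁻ b h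
  ... | j , i<j , bj with m≤n⇒m<n∨m≡n i<j
  ...   | inj₁ lt = inj₁ (above⁺ b j lt bj)
  ...   | inj₂ eq = inj₂ (subst (T ∘ b) (toℕ-injective (sym eq)) bj)

  above-self : ∀ (b : Fin (suc m) → Bool) i → T (b (suc i)) → Above (toℕ i) b
  above-self b i = above⁺ b (suc i) ≤-refl

sum-tabulate-zero : ∀ {n} (g : Fin n → ℕ) → (∀ i → g i ≡ 0) → sum (tabulate g) ≡ 0
sum-tabulate-zero {zero} g _ = refl
sum-tabulate-zero {suc n} g zeros rewrite zeros zero = sum-tabulate-zero (g ∘ suc) (zeros ∘ suc)

sum-tabulate-single : ∀ {n} (g : Fin n → ℕ) j → (∀ i → i ≢ j → g i ≡ 0) → sum (tabulate g) ≡ g j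
sum-tabulate-single g zero zeros =
  trans (cong (g zero +_) (sum-tabulate-zero (g ∘ suc) (λ i → zeros (suc i) (λ ()))))
        (+-identityʳ (g zero))
sum-tabulate-single g (suc j) zeros rewrite zeros zero (λ ()) =
  sum-tabulate-single (g ∘ suc) j (λ i i≢j → zeros (suc i) (i≢j ∘ suc-injective))

sum-tabulate-pos : ∀ {n} (g : Fin n → ℕ) → 0 < sum (tabulate g) → ∃ λ j → 0 < g j
sum-tabulate-pos {suc n} g pos with g zero in eq
... | suc _ = zero , subst (0 <_) (sym eq) (s≤s z≤n)
... | zero = let j , gj = sum-tabulate-pos (g ∘ suc) pos in suc j , gj

Enumerates : ∀ {n} → (ℕ → Fin (suc n)) → Set
Enumerates {n} ix = ∀ {t} → t ≤ n → toℕ (ix t) ≡ t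

module _ {n} {ix : ℕ → Fin (suc n)} (enum : Enumerates ix) where

  enumerates-onto : ∀ j → ix (toℕ j) ≡ j
  enumerates-onto j = toℕ-injective (enum (toℕ≤pred[n] j))

  enumerates-injective : ∀ {s t} → s ≤ n → t ≤ n → ix s ≡ ix t → s ≡ t
  enumerates-injective s≤n t≤n eq = trans (sym (enum s≤n)) (trans (cong toℕ eq) (enum t≤n))

clamp : ∀ n → ℕ → Fin (suc n)
clamp n zero = zero
clamp zero (suc t) = zero
clamp (suc n) (suc t) = suc (clamp n t)

clamp-enumerates : ∀ n → Enumerates (clamp n)
clamp-enumerates n {zero} _ = refl
clamp-enumerates (suc n) {suc t} (s≤s t≤n) = cong suc (clamp-enumerates n t≤n)

inject₁-clamp : ∀ {n t} → t ≤ n → inject₁ (clamp n t) ≡ clamp (suc n) t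
inject₁-clamp {n} t≤n = toℕ-injective (trans (toℕ-inject₁ _)
  (trans (clamp-enumerates n t≤n) (sym (clamp-enumerates (suc n) (m≤n⇒m≤1+n t≤n)))))

clamp-last : ∀ n → clamp n n ≡ fromℕ n
clamp-last zero = refl
clamp-last (suc n) = cong suc (clamp-last n)

-- rotation t is t modulo n + 1, built from the cyclic successor used in IsCycle
-- so that rotation (suc t) ≡ next (rotation t) holds by definition.
rotation : ∀ {n} → ℕ → Fin (suc n)
rotation zero = zero
rotation (suc t) = next (rotation t)

toℕ-next : ∀ {n} (j : Fin (suc n)) → toℕ j < n → toℕ (next j) ≡ suc (toℕ j)
toℕ-next {suc n} zero _ = refl
toℕ-next {suc n} (suc j) (s≤s j<n) with next j | toℕ-next j j<n
... | suc _ | eq = cong suc eq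

next-fromℕ : ∀ n → next (fromℕ n) ≡ zero
next-fromℕ zero = refl
next-fromℕ (suc n) with next (fromℕ n) | next-fromℕ n
... | zero | _ = refl

rotation-enumerates : ∀ n → Enumerates (rotation {n})
rotation-enumerates n {zero} _ = refl
rotation-enumerates n {suc t} t<n =
  trans (toℕ-next (rotation t) (subst (_< n) (sym IH) t<n)) (cong suc IH)
  where
  IH = rotation-enumerates n (<⇒≤ t<n)

rotation-wraps : ∀ n → rotation {n} (suc n) ≡ zero
rotation-wraps n =
  trans (cong next (toℕ-injective (trans (rotation-enumerates n ≤-refl) (sym (toℕ-fromℕ n)))))
        (next-fromℕ n)

module Subgraphs (G : Graph) where

  joins-sym : ∀ {e : Edge G} {x y} → Joins G e x y → Joins G e y x
  joins-sym (inj₁ (p , q)) = inj₂ (p , q)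
  joins-sym (inj₂ (p , q)) = inj₁ (p , q)

  joins-incidentˡ : ∀ {e : Edge G} {x y} → Joins G e x y → Incident G e x
  joins-incidentˡ (inj₁ (p , _)) = inj₁ p
  joins-incidentˡ (inj₂ (_ , q)) = inj₂ q

  joins-incidentʳ : ∀ {e : Edge G} {x y} → Joins G e x y → Incident G e y
  joins-incidentʳ = joins-incidentˡ ∘ joins-sym

  incident-end : ∀ {e : Edge G} {x y v} → Joins G e x y → Incident G e v → v ≡ x ⊎ v ≡ y
  incident-end (inj₁ (p , _)) (inj₁ s) = inj₁ (trans (sym s) p)
  incident-end (inj₁ (_ , q)) (inj₂ s) = inj₂ (trans (sym s) q)
  incident-end (inj₂ (p , _)) (inj₁ s) = inj₂ (trans (sym s) p)
  incident-end (inj₂ (_ , q)) (inj₂ s) = inj₁ (trans (sym s) q)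

  joins-ends : ∀ {e : Edge G} {x y x′ y′} → Joins G e x y → Joins G e x′ y′
             → (x′ ≡ x × y′ ≡ y) ⊎ (x′ ≡ y × y′ ≡ x)
  joins-ends (inj₁ (p , q)) (inj₁ (p′ , q′)) = inj₁ (trans (sym p′) p , trans (sym q′) q)
  joins-ends (inj₁ (p , q)) (inj₂ (p′ , q′)) = inj₂ (trans (sym q′) q , trans (sym p′) p)
  joins-ends (inj₂ (p , q)) (inj₁ (p′ , q′)) = inj₂ (trans (sym p′) p , trans (sym q′) q)
  joins-ends (inj₂ (p , q)) (inj₂ (p′ , q′)) = inj₁ (trans (sym q′) q , trans (sym p′) p)

  joins-nonloop : ∀ {e : Edge G} {x y} → Joins G e x y → x ≢ y → src G e ≢ tgt G e
  joins-nonloop (inj₁ (p , q)) x≢y loop = x≢y (trans (sym p) (trans loop q))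
  joins-nonloop (inj₂ (p , q)) x≢y loop = x≢y (trans (sym q) (trans (sym loop) p))

  _⊆ᴱ_ : Sub G → Sub G → Set
  S ⊆ᴱ S′ = ∀ {e} → e ∈E S → e ∈E S′

  Closed : Sub G → Set
  Closed S = ∀ {e x} → e ∈E S → Incident G e x → x ∈V S

  Bridge : Sub G → Edge G → Set
  Bridge S f = f ∈E S × ¬ Reach (S ─ f) (src G f) (tgt G f)

  infixr 5 _++ᴿ_
  _++ᴿ_ : ∀ {S : Sub G} {x y z} → Reach S x y → Reach S y z → Reach S x z
  here ++ᴿ q = q
  step e e∈ j p ++ᴿ q = step e e∈ j (p ++ᴿ q)

  reverseᴿ : ∀ {S : Sub G} {x y} → Reach S x y → Reach S y x
  reverseᴿ here = here
  reverseᴿ (step e e∈ j p) = reverseᴿ p ++ᴿ step e e∈ (joins-sym j) here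

  monoᴿ : ∀ {S S′ : Sub G} → S ⊆ᴱ S′ → ∀ {x y} → Reach S x y → Reach S′ x y
  monoᴿ _ here = here
  monoᴿ S⊆S′ (step e e∈ j p) = step e (S⊆S′ e∈) j (monoᴿ S⊆S′ p)

  reach-src-tgt : ∀ {S : Sub G} {e x y} → Joins G e x y → Reach S x y → Reach S (src G e) (tgt G e)
  reach-src-tgt {S} (inj₁ (p , q)) xy = subst₂ (Reach S) (sym p) (sym q) xy
  reach-src-tgt {S} (inj₂ (p , q)) xy = subst₂ (Reach S) (sym p) (sym q) (reverseᴿ xy)

  reach-joined : ∀ {S : Sub G} {e x y} → Joins G e x y → Reach S (src G e) (tgt G e) → Reach S x y
  reach-joined {S} (inj₁ (p , q)) st = subst₂ (Reach S) p q st
  reach-joined {S} (inj₂ (p , q)) st = subst₂ (Reach S) q p (reverseᴿ st)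

  ─⁺ : ∀ (S : Sub G) {e f} → e ∈E S → e ≢ f → e ∈E (S ─ f)
  ─⁺ S {e} {f} e∈ e≢f with e ≟ f
  ... | yes e≡f = ⊥-elim (e≢f e≡f)
  ... | no _ = Equivalence.from T-∧ (e∈ , tt)

  ─⁻ : ∀ (S : Sub G) f {e} → e ∈E (S ─ f) → e ∈E S × e ≢ f
  ─⁻ S f {e} e∈ with e ≟ f
  ... | yes _ = ⊥-elim (proj₂ (Equivalence.to T-∧ e∈))
  ... | no e≢f = proj₁ (Equivalence.to T-∧ e∈) , e≢f

  ─-mono : ∀ {S S′ : Sub G} {f} → S ⊆ᴱ S′ → (S ─ f) ⊆ᴱ (S′ ─ f)
  ─-mono {S} {S′} {f} S⊆S′ e∈ = let e∈S , e≢f = ─⁻ S f e∈ in ─⁺ S′ (S⊆S′ e∈S) e≢f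

  ⊆ᴱ-─ : ∀ {S S′ : Sub G} {f} → S ⊆ᴱ S′ → ¬ f ∈E S → S ⊆ᴱ (S′ ─ f)
  ⊆ᴱ-─ {S′ = S′} S⊆S′ f∉S e∈ = ─⁺ S′ (S⊆S′ e∈) (λ { refl → f∉S e∈ })

  reroute : ∀ {S : Sub G} {f} → Reach (S ─ f) (src G f) (tgt G f)
          → ∀ {x y} → Reach S x y → Reach (S ─ f) x y
  reroute bypass here = here
  reroute {S} {f} bypass (step e e∈ j p) with e ≟ f
  ... | yes refl = reach-joined j bypass ++ᴿ reroute bypass p
  ... | no e≢f = step e (─⁺ S e∈ e≢f) j (reroute bypass p)

  cutEdge⇒bridge : ∀ {S : Sub G} {f} → CutEdge S f → Bridge S f
  cutEdge⇒bridge (f∈ , _ , _ , _ , _ , xy , cut) = f∈ , λ bypass → cut (reroute bypass xy)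

  mult-incident : ∀ (e : Edge G) v → 0 < mult {G} e v → Incident G e v
  mult-incident e v pos with src G e ≟ v | tgt G e ≟ v
  mult-incident e v pos | yes p | _ = inj₁ p
  mult-incident e v pos | no _ | yes q = inj₂ q
  mult-incident e v () | no _ | no _

  mult-nonincident : ∀ (e : Edge G) v → ¬ Incident G e v → mult {G} e v ≡ 0
  mult-nonincident e v away with src G e ≟ v | tgt G e ≟ v
  ... | yes p | _ = ⊥-elim (away (inj₁ p))
  ... | no _ | yes q = ⊥-elim (away (inj₂ q))
  ... | no _ | no _ = refl

  mult≤1 : ∀ (e : Edge G) v → src G e ≢ tgt G e → mult {G} e v ≤ 1
  mult≤1 e v nonloop with src G e ≟ v | tgt G e ≟ v
  ... | yes p | yes q = ⊥-elim (nonloop (trans p (sym q)))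
  ... | yes _ | no _ = s≤s z≤n
  ... | no _ | yes _ = s≤s z≤n
  ... | no _ | no _ = z≤n

  deg-tabulate : ∀ (S : Sub G) v → deg S v ≡ sum (tabulate (λ e → if inE S e then mult {G} e v else 0))
  deg-tabulate S v = cong sum (map-tabulate (λ e → e) (λ e → if inE S e then mult {G} e v else 0))

  deg-pos⇒incident : ∀ {S : Sub G} {v} → 0 < deg S v → ∃ λ e → e ∈E S × Incident G e v
  deg-pos⇒incident {S} {v} pos with sum-tabulate-pos _ (subst (0 <_) (deg-tabulate S v) pos)
  ... | e , at-e with inE S e in eq
  ...   | true = e , subst T (sym eq) tt , mult-incident e v at-e
  deg-pos⇒incident pos | e , () | false

  deg-pos⇒∈ : ∀ {S : Sub G} {v} → Closed S → 0 < deg S v → v ∈V S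
  deg-pos⇒∈ {S} closed pos = let _ , e∈ , inc = deg-pos⇒incident {S} pos in closed e∈ inc

  deg≤1 : ∀ {S : Sub G} {w f} → src G f ≢ tgt G f → (∀ {g} → g ∈E S → Incident G g w → g ≡ f)
        → deg S w ≤ 1
  deg≤1 {S} {w} {f} nonloop only =
    subst (_≤ 1) (sym (trans (deg-tabulate S w) (sum-tabulate-single summand f elsewhere))) at-f
    where
    summand : Edge G → ℕ
    summand e = if inE S e then mult {G} e w else 0
    elsewhere : ∀ e → e ≢ f → summand e ≡ 0
    elsewhere e e≢f with inE S e in eq
    ... | false = refl
    ... | true = mult-nonincident e w (e≢f ∘ only (subst T (sym eq) tt))
    at-f : summand f ≤ 1
    at-f with inE S f
    ... | false = z≤n
    ... | true = mult≤1 f w nonloop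

  record Union (P C P′ : Sub G) : Set where
    field
      vertex⁻ : ∀ {v} → v ∈V P′ → v ∈V P ⊎ v ∈V C
      vertexˡ : ∀ {v} → v ∈V P → v ∈V P′
      vertexʳ : ∀ {v} → v ∈V C → v ∈V P′
      edge⁻ : ∀ {e} → e ∈E P′ → e ∈E P ⊎ e ∈E C
      edgeˡ : P ⊆ᴱ P′
      edgeʳ : C ⊆ᴱ P′

  record SingleEdge (C : Sub G) (g : Edge G) : Set where
    field
      vertex⁻ : ∀ {x} → x ∈V C → Incident G g x
      vertex⁺ : ∀ {x} → Incident G g x → x ∈V C
      edge⁻ : ∀ {f} → f ∈E C → f ≡ g
      edge⁺ : g ∈E C

  -- C listed as vertex 0, edge 0, vertex 1, …, vertex len; vertex and edge are junk
  -- beyond len.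
  record Trail (C : Sub G) : Set where
    field
      len : ℕ
      vertex : ℕ → Vtx G
      edge : ℕ → Edge G
      joins : ∀ {t} → t < len → Joins G (edge t) (vertex t) (vertex (suc t))
      edge-injective : ∀ {s t} → s < len → t < len → edge s ≡ edge t → s ≡ t
      vertex∈ : ∀ {t} → t ≤ len → vertex t ∈V C
      edge∈ : ∀ {t} → t < len → edge t ∈E C
      vertex-onto : ∀ {v} → v ∈V C → ∃ λ t → t ≤ len × vertex t ≡ v
      edge-onto : ∀ {e} → e ∈E C → ∃ λ t → t < len × edge t ≡ e

    segment : ∀ {S a} b → a ≤ b → b ≤ len → (∀ {t} → a ≤ t → t < b → edge t ∈E S)
            → Reach S (vertex a) (vertex b)
    segment b a≤b b≤len inS with m≤n⇒m<n∨m≡n a≤b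
    segment b _ _ _ | inj₂ refl = here
    segment (suc b) _ b<len inS | inj₁ (s≤s a≤b) =
      segment b a≤b (<⇒≤ b<len) (λ a≤t t<b → inS a≤t (m<n⇒m<1+n t<b))
      ++ᴿ step (edge b) (inS a≤b ≤-refl) (joins b<len) here

  -- What is used of a path from a to b, or of a cycle through a = b.
  record Ear (C : Sub G) (a b : Vtx G) : Set where
    field
      start∈ : a ∈V C
      end∈ : b ∈V C
      closed : Closed C
      spans : ∀ {x} → x ∈V C → Reach C a x
      splits : ∀ {f} → f ∈E C → ∃₂ λ x y → Joins G f x y × Reach (C ─ f) a x × Reach (C ─ f) y b

  trail-ear : ∀ {C} (tr : Trail C) → Ear C (Trail.vertex tr 0) (Trail.vertex tr (Trail.len tr))
  trail-ear {C} tr = record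
    { start∈ = vertex∈ z≤n ; end∈ = vertex∈ ≤-refl ; closed = closed ; spans = spans ; splits = splits }
    where
    open Trail tr
    closed : Closed C
    closed e∈ inc with edge-onto e∈
    ... | t , t<len , refl with incident-end (joins t<len) inc
    ...   | inj₁ refl = vertex∈ (<⇒≤ t<len)
    ...   | inj₂ refl = vertex∈ t<len
    spans : ∀ {x} → x ∈V C → Reach C (vertex 0) x
    spans x∈ with vertex-onto x∈
    ... | t , t≤len , refl = segment {S = C} t z≤n t≤len (λ _ s<t → edge∈ (<-≤-trans s<t t≤len))
    splits : ∀ {f} → f ∈E C
           → ∃₂ λ x y → Joins G f x y × Reach (C ─ f) (vertex 0) x × Reach (C ─ f) y (vertex len)
    splits f∈ with edge-onto f∈
    ... | j , j<len , refl =
          vertex j , vertex (suc j) , joins j<len ,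
          segment {S = C ─ edge j} j z≤n (<⇒≤ j<len) before ,
          segment {S = C ─ edge j} len j<len ≤-refl after
      where
      before : ∀ {t} → 0 ≤ t → t < j → edge t ∈E (C ─ edge j)
      before _ t<j =
        ─⁺ C (edge∈ (<-trans t<j j<len)) (λ eq → <-irrefl (edge-injective (<-trans t<j j<len) j<len eq) t<j)
      after : ∀ {t} → suc j ≤ t → t < len → edge t ∈E (C ─ edge j)
      after j<t t<len = ─⁺ C (edge∈ t<len) (λ eq → <-irrefl (sym (edge-injective t<len j<len eq)) j<t)

  spanned-trail : ∀ {C p k} {vs : Fin (suc p) → Vtx G} {es : Fin (suc k) → Edge G}
                    {iV : ℕ → Fin (suc p)} {iE : ℕ → Fin (suc k)}
                → Enumerates iV → Enumerates iE → p ≤ suc k → Injective es → SpannedBy C vs es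
                → (∀ {t} → t ≤ k → Joins G (es (iE t)) (vs (iV t)) (vs (iV (suc t))))
                → Trail C
  spanned-trail {C} {p} {k} {vs} {es} {iV} {iE} enumV enumE p≤ es-inj (vspan , espan) jn = record
    { len = suc k ; vertex = vs ∘ iV ; edge = es ∘ iE
    ; joins = λ { (s≤s t≤k) → jn t≤k }
    ; edge-injective = λ { (s≤s s≤k) (s≤s t≤k) eq →
                               enumerates-injective enumE s≤k t≤k (es-inj _ _ eq) }
    ; vertex∈ = λ {t} _ → proj₂ (vspan _) (iV t , refl)
    ; edge∈ = λ {t} _ → proj₂ (espan _) (iE t , refl)
    ; vertex-onto = vertex-onto ; edge-onto = edge-onto }
    where
    vertex-onto : ∀ {v} → v ∈V C → ∃ λ t → t ≤ suc k × vs (iV t) ≡ v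
    vertex-onto v∈ with proj₁ (vspan _) v∈
    ... | j , refl = toℕ j , ≤-trans (toℕ≤pred[n] j) p≤ , cong vs (enumerates-onto enumV j)
    edge-onto : ∀ {e} → e ∈E C → ∃ λ t → t < suc k × es (iE t) ≡ e
    edge-onto e∈ with proj₁ (espan _) e∈
    ... | j , refl = toℕ j , s≤s (toℕ≤pred[n] j) , cong es (enumerates-onto enumE j)

  path-ear : ∀ {C a b} → IsPath C a b → Ear C a b × a ≢ b
  path-ear {C} (k , vs , es , vs-inj , es-inj , jn , span , refl , refl) =
    subst (Ear C (vs zero)) (cong vs (clamp-last (suc k))) (trail-ear tr) , 0≢1+n ∘ vs-inj _ _
    where
    tr : Trail C
    tr = spanned-trail (clamp-enumerates (suc k)) (clamp-enumerates k) ≤-refl es-inj span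
           (λ {t} t≤k → subst (λ i → Joins G (es (clamp k t)) (vs i) (vs (suc (clamp k t))))
                              (inject₁-clamp t≤k) (jn (clamp k t)))

  cycle-ear : ∀ {C} → IsCycle C → ∃ λ a → Ear C a a
  cycle-ear {C} (k , vs , es , _ , es-inj , jn , span) =
    vs zero , subst (Ear C (vs zero)) (cong vs (rotation-wraps k)) (trail-ear tr)
    where
    tr : Trail C
    tr = spanned-trail (rotation-enumerates k) (rotation-enumerates k) (n≤1+n k) es-inj span
           (λ {t} _ → jn (rotation t))

module Growing {G : Graph} (r : Vtx G) (OneWay : Edge G → Set) where

  open Subgraphs G

  Firm : Sub G → Vtx G → Set
  Firm P v = v ≡ r ⊎ 2 ≤ deg P v

  Anchored : Sub G → Vtx G → Set
  Anchored P v = Firm P v ⊎ v ∈V P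

  data Attachment (P C : Sub G) : Set where
    open-ear : ∀ {a b} → Ear C a b → a ≢ b → Anchored P a → Anchored P b → Attachment P C
    closed-ear : ∀ {a v} → Ear C a a → v ∈V C → Firm P v → Attachment P C
    one-way-edge : ∀ {g u v} → SingleEdge C g → Joins G g u v → Firm P u → OneWay g → Attachment P C

  record Growth (P C P′ : Sub G) : Set where
    field
      union : Union P C P′
      attachment : Attachment P C
      disjoint : ∀ {e} → e ∈E C → ¬ e ∈E P

  record Pendant (P : Sub G) (f : Edge G) : Set where
    field
      leaf other : Vtx G
      joins : Joins G f leaf other
      nonloop : leaf ≢ other
      leaf≢r : leaf ≢ r
      leaf∈ : leaf ∈V P
      only : ∀ {g} → g ∈E P → Incident G g leaf → g ≡ f

  record Grown (P : Sub G) : Set where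
    field
      closed : Closed P
      rooted : ∀ {x} → x ∈V P → Reach P r x
      bridges : ∀ {f} → Bridge P f → OneWay f × Pendant P f

  Tame : Sub G → Set
  Tame P = Connected P × (∀ e → CutEdge P e → OneWay e × HasTrivialComponent P e)

  firm-root-or-∈ : ∀ {P v} → Closed P → Firm P v → v ≡ r ⊎ v ∈V P
  firm-root-or-∈ _ (inj₁ v≡r) = inj₁ v≡r
  firm-root-or-∈ {P} closed (inj₂ d) = inj₂ (deg-pos⇒∈ {P} closed (<-≤-trans (s≤s z≤n) d))

  anchored-reach : ∀ {P v} → Grown P → Anchored P v → Reach P r v
  anchored-reach grown (inj₂ v∈) = Grown.rooted grown v∈
  anchored-reach {P} grown (inj₁ firm) with firm-root-or-∈ {P} (Grown.closed grown) firm
  ... | inj₁ refl = here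
  ... | inj₂ v∈ = Grown.rooted grown v∈

  leaf-not-firm : ∀ {P f} (p : Pendant P f) → ¬ Firm P (Pendant.leaf p)
  leaf-not-firm p (inj₁ leaf≡r) = Pendant.leaf≢r p leaf≡r
  leaf-not-firm {P} p (inj₂ d) with ≤-trans d (deg≤1 {P} (joins-nonloop joins nonloop) only)
    where open Pendant p
  ... | s≤s ()

  leaf-bypass : ∀ {P f} (p : Pendant P f) {x y} → x ≢ Pendant.leaf p → y ≢ Pendant.leaf p
              → Reach P x y → Reach (P ─ f) x y
  leaf-bypass {P} {f} p x≢w y≢w walk = from-other walk x≢w y≢w
    where
    open Pendant p renaming (leaf to w; other to z)
    from-other : ∀ {x y} → Reach P x y → x ≢ w → y ≢ w → Reach (P ─ f) x y
    from-leaf : ∀ {y} → Reach P w y → y ≢ w → Reach (P ─ f) z y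
    from-other here _ _ = here
    from-other (step e e∈ j rest) x≢w y≢w with e ≟ f
    ... | no e≢f = step e (─⁺ P e∈ e≢f) j (from-other rest x′≢w y≢w)
      where
      x′≢w = λ x′≡w → e≢f (only e∈ (subst (Incident G e) x′≡w (joins-incidentʳ j)))
    ... | yes refl with joins-ends joins j
    ...   | inj₁ (x≡w , _) = ⊥-elim (x≢w x≡w)
    ...   | inj₂ (refl , refl) = from-leaf rest y≢w
    from-leaf here y≢w = ⊥-elim (y≢w refl)
    from-leaf (step e e∈ j rest) y≢w with only e∈ (joins-incidentˡ j)
    ... | refl with joins-ends joins j
    ...   | inj₁ (_ , refl) = from-other rest (nonloop ∘ sym) y≢w
    ...   | inj₂ (w≡z , _) = ⊥-elim (nonloop w≡z)

  leaf-escape : ∀ {P P′ f c} → Grown P → P ⊆ᴱ P′ → f ∈E P → (p : Pendant P f)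
              → Reach (P′ ─ f) (Pendant.leaf p) c → c ≢ Pendant.leaf p → Reach P r c
              → Reach (P′ ─ f) (src G f) (tgt G f)
  leaf-escape {P} {P′} {f} grown P⊆P′ f∈ p leaf→c c≢leaf r→c =
    reach-src-tgt joins (leaf→c ++ᴿ monoᴿ (─-mono {P} {P′} {f} P⊆P′) c→other)
    where
    open Pendant p
    r→other = Grown.rooted grown (Grown.closed grown f∈ (joins-incidentʳ joins))
    c→other = leaf-bypass p c≢leaf (nonloop ∘ sym) (reverseᴿ r→c ++ᴿ r→other)

  attachment-closed : ∀ {P C} → Attachment P C → Closed C
  attachment-closed (open-ear ear _ _ _) = Ear.closed ear
  attachment-closed (closed-ear ear _ _) = Ear.closed ear
  attachment-closed (one-way-edge single _ _ _) e∈ inc =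
    SingleEdge.vertex⁺ single (subst (λ h → Incident G h _) (SingleEdge.edge⁻ single e∈) inc)

  attachment-inhabited : ∀ {P C} → Attachment P C → ∃ (_∈V C)
  attachment-inhabited (open-ear ear _ _ _) = _ , Ear.start∈ ear
  attachment-inhabited (closed-ear _ v∈ _) = _ , v∈
  attachment-inhabited (one-way-edge single j _ _) =
    _ , SingleEdge.vertex⁺ single (joins-incidentˡ j)

  attachment-reach : ∀ {P C x} → Attachment P C → x ∈V C → ∃ λ c → Anchored P c × Reach C c x
  attachment-reach (open-ear ear _ a-anchored _) x∈ = _ , a-anchored , Ear.spans ear x∈
  attachment-reach (closed-ear ear v∈ v-firm) x∈ =
    _ , inj₁ v-firm , reverseᴿ (Ear.spans ear v∈) ++ᴿ Ear.spans ear x∈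
  attachment-reach (one-way-edge single j u-firm _) x∈
    with incident-end j (SingleEdge.vertex⁻ single x∈)
  ... | inj₁ refl = _ , inj₁ u-firm , here
  ... | inj₂ refl = _ , inj₁ u-firm , step _ (SingleEdge.edge⁺ single) j here

  attachment-exit : ∀ {P C w} → Attachment P C → w ∈V C → ¬ Firm P w
                  → ∃ λ c → c ≢ w × Anchored P c × Reach C w c
  attachment-exit {w = w} (open-ear {a} {b} ear a≢b _ b-anchored) w∈ _ with w ≟ a
  ... | yes refl = b , a≢b ∘ sym , b-anchored , Ear.spans ear (Ear.end∈ ear)
  attachment-exit (open-ear ear _ a-anchored _) w∈ _ | no w≢a =
    _ , w≢a ∘ sym , a-anchored , reverseᴿ (Ear.spans ear w∈)
  attachment-exit {P} (closed-ear ear v∈ v-firm) w∈ w-loose =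
    _ , (λ v≡w → w-loose (subst (Firm P) v≡w v-firm)) , inj₁ v-firm ,
    reverseᴿ (Ear.spans ear w∈) ++ᴿ Ear.spans ear v∈
  attachment-exit {P} (one-way-edge single j u-firm _) w∈ w-loose
    with incident-end j (SingleEdge.vertex⁻ single w∈)
  ... | inj₁ refl = ⊥-elim (w-loose u-firm)
  ... | inj₂ refl =
    _ , (λ u≡w → w-loose (subst (Firm P) u≡w u-firm)) , inj₁ u-firm ,
    step _ (SingleEdge.edge⁺ single) (joins-sym j) here

  module _ {P C P′} (grown : Grown P) (growth : Growth P C P′) where
    open Growth growth
    open Union union

    lift-old : ∀ {f} → f ∈E C → ∀ {x y} → Reach P x y → Reach (P′ ─ f) x y
    lift-old {f} f∈C = monoᴿ (⊆ᴱ-─ {P} {P′} {f} edgeˡ (disjoint f∈C))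

    lift-new : ∀ {f x y} → Reach (C ─ f) x y → Reach (P′ ─ f) x y
    lift-new {f} = monoᴿ (─-mono {C} {P′} {f} edgeʳ)

    one-way-shortcut : ∀ {g u v} → SingleEdge C g → Joins G g u v → Firm P u → Reach P r v
                     → Reach (P′ ─ g) (src G g) (tgt G g)
    one-way-shortcut single j u-firm r→v =
      let u→r = reverseᴿ (anchored-reach grown (inj₁ u-firm))
      in reach-src-tgt j (lift-old (SingleEdge.edge⁺ single) (u→r ++ᴿ r→v))

    one-way-bridge : ∀ {g u v} → SingleEdge C g → Joins G g u v → Firm P u → OneWay g → Bridge P′ g
                   → OneWay g × Pendant P′ g
    one-way-bridge {g} {u} {v} single j u-firm one-way (_ , no-bypass) with v ≟ r | T? (inV P v)
    ... | yes refl | _ = ⊥-elim (no-bypass (via-root here))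
      where via-root = one-way-shortcut single j u-firm
    ... | no _ | yes v∈P = ⊥-elim (no-bypass (via-root (Grown.rooted grown v∈P)))
      where via-root = one-way-shortcut single j u-firm
    ... | no v≢r | no v∉P = one-way , record
      { leaf = v ; other = u ; joins = joins-sym j ; nonloop = v≢u ; leaf≢r = v≢r
      ; leaf∈ = vertexʳ (SingleEdge.vertex⁺ single (joins-incidentʳ j)) ; only = only }
      where
      v≢u : v ≢ u
      v≢u v≡u =
        [ v≢r , v∉P ]′ (firm-root-or-∈ {P} (Grown.closed grown) (subst (Firm P) (sym v≡u) u-firm))
      only : ∀ {h} → h ∈E P′ → Incident G h v → h ≡ g
      only h∈ inc with edge⁻ h∈
      ... | inj₁ h∈P = ⊥-elim (v∉P (Grown.closed grown h∈P inc))
      ... | inj₂ h∈C = SingleEdge.edge⁻ single h∈C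

    new-bridge : ∀ {f} → f ∈E C → Bridge P′ f → OneWay f × Pendant P′ f
    new-bridge {f} f∈C bridge@(_ , no-bypass) with attachment
    ... | open-ear ear _ a-anchored b-anchored =
      let x , y , j , a→x , y→b = Ear.splits ear f∈C
          a→b = reverseᴿ (anchored-reach grown a-anchored) ++ᴿ anchored-reach grown b-anchored
          x→y = reverseᴿ (lift-new a→x) ++ᴿ lift-old f∈C a→b ++ᴿ reverseᴿ (lift-new y→b)
      in ⊥-elim (no-bypass (reach-src-tgt j x→y))
    ... | closed-ear ear _ _ =
      let x , y , j , a→x , y→a = Ear.splits ear f∈C
      in ⊥-elim (no-bypass (reach-src-tgt j (reverseᴿ (lift-new a→x) ++ᴿ reverseᴿ (lift-new y→a))))
    ... | one-way-edge single j u-firm one-way with SingleEdge.edge⁻ single f∈C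
    ...   | refl = one-way-bridge single j u-firm one-way bridge

    old-bridge : ∀ {f} → f ∈E P → Bridge P′ f → OneWay f × Pendant P′ f
    old-bridge {f} f∈P (_ , no-bypass)
      with Grown.bridges grown (f∈P , no-bypass ∘ monoᴿ (─-mono {P} {P′} {f} edgeˡ))
    ... | one-way , p = one-way , record
      { leaf = leaf ; other = other ; joins = joins ; nonloop = nonloop ; leaf≢r = leaf≢r
      ; leaf∈ = vertexˡ leaf∈ ; only = only′ }
      where
      open Pendant p
      only′ : ∀ {g} → g ∈E P′ → Incident G g leaf → g ≡ f
      only′ g∈ inc with edge⁻ g∈
      ... | inj₁ g∈P = only g∈P inc
      ... | inj₂ g∈C with attachment-exit attachment (attachment-closed attachment g∈C inc) (leaf-not-firm p)
      ...   | c , c≢leaf , c-anchored , leaf→c =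
        ⊥-elim (no-bypass (leaf-escape grown edgeˡ f∈P p (monoᴿ C⊆P′─f leaf→c) c≢leaf
                                       (anchored-reach grown c-anchored)))
        where
        C⊆P′─f = ⊆ᴱ-─ {C} {P′} {f} edgeʳ (λ f∈C → disjoint f∈C f∈P)

    grow : Grown P′
    grow = record { closed = closed ; rooted = rooted ; bridges = bridges }
      where
      closed : Closed P′
      closed e∈ inc with edge⁻ e∈
      ... | inj₁ e∈P = vertexˡ (Grown.closed grown e∈P inc)
      ... | inj₂ e∈C = vertexʳ (attachment-closed attachment e∈C inc)
      rooted : ∀ {x} → x ∈V P′ → Reach P′ r x
      rooted x∈ with vertex⁻ x∈
      ... | inj₁ x∈P = monoᴿ edgeˡ (Grown.rooted grown x∈P)
      ... | inj₂ x∈C = let _ , c-anchored , c→x = attachment-reach attachment x∈C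
                       in monoᴿ edgeˡ (anchored-reach grown c-anchored) ++ᴿ monoᴿ edgeʳ c→x
      bridges : ∀ {f} → Bridge P′ f → OneWay f × Pendant P′ f
      bridges bridge with edge⁻ (proj₁ bridge)
      ... | inj₁ f∈P = old-bridge f∈P bridge
      ... | inj₂ f∈C = new-bridge f∈C bridge

  empty-grown : ∀ {P} → (∀ {v} → ¬ v ∈V P) → (∀ {e} → ¬ e ∈E P) → Grown P
  empty-grown no-vertex no-edge = record
    { closed = λ e∈ _ → ⊥-elim (no-edge e∈)
    ; rooted = ⊥-elim ∘ no-vertex
    ; bridges = ⊥-elim ∘ no-edge ∘ proj₁ }

  pendant-trivial : ∀ {P f} → Pendant P f → HasTrivialComponent P f
  pendant-trivial {P} {f} p = leaf , leaf∈ , stuck , isolated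
    where
    open Pendant p
    isolated : ∀ g → g ∈E (P ─ f) → ¬ Incident G g leaf
    isolated g g∈ inc = let g∈P , g≢f = ─⁻ P f g∈ in g≢f (only g∈P inc)
    stuck : ∀ x → Reach (P ─ f) leaf x → x ≡ leaf
    stuck _ here = refl
    stuck _ (step g g∈ j _) = ⊥-elim (isolated g g∈ (joins-incidentˡ j))

  grown-tame : ∀ {P} → Grown P → ∃ (_∈V P) → Tame P
  grown-tame grown inhabited =
    (inhabited , λ x y x∈ y∈ → reverseᴿ (rooted x∈) ++ᴿ rooted y∈) ,
    λ e cut → let one-way , p = bridges (cutEdge⇒bridge cut) in one-way , pendant-trivial p
    where open Grown grown

  tower-tame : (P : ℕ → Sub G) (n : ℕ) → (∀ {v} → ¬ v ∈V P 0) → (∀ {e} → ¬ e ∈E P 0)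
             → (∀ {k} → k < n → ∃ λ C → Growth (P k) C (P (suc k)))
             → ∀ {k} → 0 < k → k ≤ n → Tame (P k)
  tower-tame P n no-vertex no-edge growth {suc k} _ k<n = grown-tame (grown (suc k) k<n) inhabited
    where
    inhabited : ∃ (_∈V P (suc k))
    inhabited = let _ , g = growth k<n ; v , v∈ = attachment-inhabited (Growth.attachment g)
                in v , Union.vertexʳ (Growth.union g) v∈
    grown : ∀ k → k ≤ n → Grown (P k)
    grown zero _ = empty-grown no-vertex no-edge
    grown (suc k) k<n = grow (grown k (<⇒≤ k<n)) (proj₂ (growth k<n))

  up-attachments : ∀ {H Hb C : Sub G} → UpChain r H Hb C → Attachment H C × Attachment Hb C
  up-attachments {H} (_ , inj₁ (_ , _ , path , firm , a-end , b-end)) =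
    let ear , a≢b = path-ear path
    in open-ear ear a≢b (end-anchored a-end) (end-anchored b-end) ,
       open-ear ear a≢b (inj₁ (firm _ (Ear.start∈ ear))) (inj₁ (firm _ (Ear.end∈ ear)))
    where
    end-anchored : ∀ {x} → x ≡ r ⊎ x ∈V H → Anchored H x
    end-anchored = [ inj₁ ∘ inj₁ , inj₂ ]′
  up-attachments (_ , inj₂ (cycle , firm , _ , v∈ , v-firm)) =
    let _ , ear = cycle-ear cycle
    in closed-ear ear v∈ v-firm , closed-ear ear (Ear.start∈ ear) (firm _ (Ear.start∈ ear))

  one-way-attachments : ∀ {H Hb C} (ow : OneWayChain r H Hb C) → OneWay (proj₁ ow)
                      → Attachment H C × Attachment Hb C
  one-way-attachments (g , _ , _ , vspan , espan , _ , _ , j , u-firm , v-firm) one-way =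
    one-way-edge single j u-firm one-way , one-way-edge single (joins-sym j) v-firm one-way
    where
    single = record { vertex⁻ = proj₁ (vspan _) ; vertex⁺ = proj₂ (vspan _)
                    ; edge⁻ = proj₁ (espan _) ; edge⁺ = proj₂ (espan g) refl }

  chain-attachments : ∀ {H Hb C : Sub G} → IsChain r H Hb C
                    → ((ow : OneWayChain r H Hb C) → OneWay (proj₁ ow))
                    → Attachment H C × Attachment Hb C
  chain-attachments (inj₁ up) _ = up-attachments up
  chain-attachments (inj₂ (inj₁ down)) _ = swap (up-attachments down)
  chain-attachments (inj₂ (inj₂ ow)) one-way = one-way-attachments ow (one-way ow)

  chain-disjoint : ∀ {H Hb C : Sub G} → IsChain r H Hb C → ∀ {e} → e ∈E C → ¬ e ∈E H × ¬ e ∈E Hb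
  chain-disjoint (inj₁ (disjoint , _)) e∈ = disjoint _ e∈
  chain-disjoint (inj₂ (inj₁ (disjoint , _))) e∈ = swap (disjoint _ e∈)
  chain-disjoint (inj₂ (inj₂ (_ , g∉H , g∉Hb , _ , espan , _))) e∈ with proj₁ (espan _) e∈
  ... | refl = g∉H , g∉Hb

module Decomposition {G : Graph} (r : Vtx G) {m : ℕ} (Gs : Fin (suc m) → Sub G)
                     (decomposition : IsChainDecomposition r m Gs) where

  OneWay : Edge G → Set
  OneWay e = ∀ j → e ∈E Gs j → OneWayChain {G} r (Hpre Gs (toℕ j)) (Hsuf Gs (toℕ j)) (Gs j)

  open Subgraphs G
  open Growing {G} r OneWay

  Hpre-union : ∀ j → Union (Hpre Gs (toℕ j)) (Gs j) (Hpre Gs (suc (toℕ j)))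
  Hpre-union j = record
    { vertex⁻ = λ {v} → below-suc⁻ (λ i → inV (Gs i) v) j
    ; vertexˡ = λ {v} → below-suc (λ i → inV (Gs i) v)
    ; vertexʳ = λ {v} → below-self (λ i → inV (Gs i) v) j
    ; edge⁻ = λ {e} → below-suc⁻ (λ i → inE (Gs i) e) j
    ; edgeˡ = λ {e} → below-suc (λ i → inE (Gs i) e)
    ; edgeʳ = λ {e} → below-self (λ i → inE (Gs i) e) j }

  Hsuf-union : ∀ (j : Fin m) → Union (Hsuf Gs (suc (toℕ j))) (Gs (suc j)) (Hsuf Gs (toℕ j))
  Hsuf-union j = record
    { vertex⁻ = λ {v} → above-pred⁻ (λ i → inV (Gs i) v) j
    ; vertexˡ = λ {v} → above-pred (λ i → inV (Gs i) v)
    ; vertexʳ = λ {v} → above-self (λ i → inV (Gs i) v) j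
    ; edge⁻ = λ {e} → above-pred⁻ (λ i → inE (Gs i) e) j
    ; edgeˡ = λ {e} → above-pred (λ i → inE (Gs i) e)
    ; edgeʳ = λ {e} → above-self (λ i → inE (Gs i) e) j }

  chain-one-way : ∀ j (ow : OneWayChain {G} r (Hpre Gs (toℕ j)) (Hsuf Gs (toℕ j)) (Gs j))
                → OneWay (proj₁ ow)
  chain-one-way j ow@(g , _ , _ , _ , espan , _) j′ g∈ =
    let _ , _ , unique = proj₁ decomposition g
    in subst (λ i → OneWayChain {G} r (Hpre Gs (toℕ i)) (Hsuf Gs (toℕ i)) (Gs i))
             (trans (unique j (proj₂ (espan g) refl)) (sym (unique j′ g∈))) ow

  chain-attachment : ∀ j
                   → Attachment (Hpre Gs (toℕ j)) (Gs j) × Attachment (Hsuf Gs (toℕ j)) (Gs j)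
  chain-attachment j = chain-attachments (proj₂ decomposition j) (chain-one-way j)

  Hpre-growth : ∀ j → Growth (Hpre Gs (toℕ j)) (Gs j) (Hpre Gs (suc (toℕ j)))
  Hpre-growth j = record
    { union = Hpre-union j
    ; attachment = proj₁ (chain-attachment j)
    ; disjoint = λ e∈ → proj₁ (chain-disjoint (proj₂ decomposition j) e∈) }

  Hsuf-growth : ∀ (j : Fin m) → Growth (Hsuf Gs (suc (toℕ j))) (Gs (suc j)) (Hsuf Gs (toℕ j))
  Hsuf-growth j = record
    { union = Hsuf-union j
    ; attachment = proj₂ (chain-attachment (suc j))
    ; disjoint = λ e∈ → proj₂ (chain-disjoint (proj₂ decomposition (suc j)) e∈) }

  Hpre-tame : ∀ {i} → 0 < i → i ≤ m → Tame (Hpre Gs i)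
  Hpre-tame = tower-tame (Hpre Gs) m (λ {v} → below-zero (λ i → inV (Gs i) v))
                                     (λ {e} → below-zero (λ i → inE (Gs i) e)) growth
    where
    growth : ∀ {k} → k < m → ∃ λ C → Growth (Hpre Gs k) C (Hpre Gs (suc k))
    growth k<m = let j = fromℕ< (m<n⇒m<1+n k<m) in
      Gs j , subst (λ k → Growth (Hpre Gs k) (Gs j) (Hpre Gs (suc k))) (toℕ-fromℕ< _) (Hpre-growth j)

  -- H̄_i is grown from H̄_m = ∅ by adding G_m, G_{m-1}, …; stage k of this tower is H̄_{m-k}.
  Hsuf-tame : ∀ {i} → i < m → Tame (Hsuf Gs i)
  Hsuf-tame {i} i<m =
    subst (Tame ∘ Hsuf Gs) (m∸[m∸n]≡n (<⇒≤ i<m))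
      (tower-tame (λ k → Hsuf Gs (m ∸ k)) m (λ {v} → above-last (λ i → inV (Gs i) v))
                  (λ {e} → above-last (λ i → inE (Gs i) e)) growth (m<n⇒0<n∸m i<m) (m∸n≤m m i))
    where
    growth : ∀ {k} → k < m → ∃ λ C → Growth (Hsuf Gs (m ∸ k)) C (Hsuf Gs (m ∸ suc k))
    growth {k} k<m =
      Gs (suc j) ,
      subst₂ (λ p q → Growth (Hsuf Gs p) (Gs (suc j)) (Hsuf Gs q)) shift (toℕ-fromℕ< _) (Hsuf-growth j)
      where
      j : Fin m
      j = fromℕ< (∸-monoʳ-< (s≤s z≤n) k<m)
      shift : suc (toℕ j) ≡ m ∸ k
      shift = trans (cong suc (toℕ-fromℕ< _)) (sym (+-∸-assoc 1 k<m))

proposition5 : (G : Graph) (r : Vtx G) (m : ℕ) (Gs : Fin (suc m) → Sub G)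
    → IsChainDecomposition r m Gs
    → ∀ (i : ℕ) → 1 ≤ i → i ≤ m
    → Connected (Hpre Gs i) × Connected (Hsuf Gs (i ∸ 1))
      × (∀ e → CutEdge (Hpre Gs i) e
           → (∀ j → e ∈E Gs j → OneWayChain r (Hpre Gs (toℕ j)) (Hsuf Gs (toℕ j)) (Gs j))
             × HasTrivialComponent (Hpre Gs i) e)
      × (∀ e → CutEdge (Hsuf Gs (i ∸ 1)) e
           → (∀ j → e ∈E Gs j → OneWayChain r (Hpre Gs (toℕ j)) (Hsuf Gs (toℕ j)) (Gs j))
             × HasTrivialComponent (Hsuf Gs (i ∸ 1)) e)
proposition5 G r m Gs decomposition (suc i) _ i<m =
  let connected-pre , cuts-pre = Hpre-tame (s≤s z≤n) i<m
      connected-suf , cuts-suf = Hsuf-tame i<m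
  in connected-pre , connected-suf , cuts-pre , cuts-suf
  where open Decomposition r Gs decomposition
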